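{- $\chi_p(B_4) = 3$, where $B_4$ is the complete binary tree with $4$ layers.
   Context: All graphs are finite, simple and undirected. A vertex colouring $c: V(G)\to\{1,\dots,k\}$ of a graph $G$ is a parity vertex colouring if every (non-empty, simple) path in $G$ contains some colour an odd number of times (counting occurrences on the vertices of the path). $\chi_p(G)$ is the minimum number of colours in a parity vertex colouring of $G$. $B_d$ denotes the complete binary tree with $d$ layers (so $2^d-1$ vertices). -}

module Defs where

open import Data.Nat using (ℕ; zero; suc; _+_; _*_; _^_; _∸_; _<_; _%_; s≤s)
open import Data.Nat.Properties using (<⇒≢; m≤m+n; +-suc; ≤-trans)
open import Data.Fin using (Fin; toℕ)
open import Data.Fin.Properties using (_≟_)
open import Data.List using (List; []; _∷_)
open import Data.List.Relation.Unary.Unique.Propositional using (Unique)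
open import Data.Product using (∃; _×_; _,_)
open import Data.Sum using (_⊎_; inj₁; inj₂)
open import Relation.Binary.PropositionalEquality using (_≡_)
open import Relation.Nullary using (¬_; yes; no)

record Graph : Set₁ where
  field
    n      : ℕ
    Adj    : Fin n → Fin n → Set
    sym    : ∀ {u v} → Adj u v → Adj v u
    irrefl : ∀ {u} → ¬ Adj u u
open Graph public

data Walk (G : Graph) : List (Fin (n G)) → Set where
  single : ∀ v → Walk G (v ∷ [])
  step   : ∀ {u v vs} → Adj G u v → Walk G (v ∷ vs) → Walk G (u ∷ v ∷ vs)

IsPath : (G : Graph) → List (Fin (n G)) → Set
IsPath G vs = Walk G vs × Unique vs

count : ∀ {m k} → (Fin m → Fin k) → Fin k → List (Fin m) → ℕ
count c j [] = 0
count c j (v ∷ vs) with c v ≟ j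
... | yes _ = suc (count c j vs)
... | no _  = count c j vs

IsParityColouring : (G : Graph) (k : ℕ) → (Fin (n G) → Fin k) → Set
IsParityColouring G k c =
  ∀ (vs : List (Fin (n G))) → IsPath G vs → ∃ λ (j : Fin k) → count c j vs % 2 ≡ 1

ParityColourable : Graph → ℕ → Set
ParityColourable G k = ∃ λ (c : Fin (n G) → Fin k) → IsParityColouring G k c

ChiP≡ : Graph → ℕ → Set
ChiP≡ G k = ParityColourable G k × (∀ m → m < k → ¬ ParityColourable G m)

-- Complete binary tree B_d with d layers: vertices 0 .. 2^d - 2 (heap order),
-- vertex i is adjacent to its children 2i+1 and 2i+2 (when present).
BAdj : ∀ d → Fin (2 ^ d ∸ 1) → Fin (2 ^ d ∸ 1) → Set
BAdj d u v = (toℕ v ≡ 2 * toℕ u + 1 ⊎ toℕ v ≡ 2 * toℕ u + 2)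
           ⊎ (toℕ u ≡ 2 * toℕ v + 1 ⊎ toℕ u ≡ 2 * toℕ v + 2)

BAdj-sym : ∀ d {u v} → BAdj d u v → BAdj d v u
BAdj-sym d (inj₁ p) = inj₂ p
BAdj-sym d (inj₂ p) = inj₁ p

private
  lt : ∀ x c → x < 2 * x + suc c
  lt x c rewrite +-suc (2 * x) c = s≤s (≤-trans (m≤m+n x (x + 0)) (m≤m+n (x + (x + 0)) c))

  ne : ∀ x c → ¬ (x ≡ 2 * x + suc c)
  ne x c = <⇒≢ (lt x c)

BAdj-irrefl : ∀ d {u} → ¬ BAdj d u u
BAdj-irrefl d {u} (inj₁ (inj₁ p)) = ne (toℕ u) 0 p
BAdj-irrefl d {u} (inj₁ (inj₂ p)) = ne (toℕ u) 1 p
BAdj-irrefl d {u} (inj₂ (inj₁ p)) = ne (toℕ u) 0 p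
BAdj-irrefl d {u} (inj₂ (inj₂ p)) = ne (toℕ u) 1 p

B : ℕ → Graph
B d = record { n = 2 ^ d ∸ 1 ; Adj = BAdj d ; sym = BAdj-sym d ; irrefl = BAdj-irrefl d }

module Submission where

-- We give an explicit 3-colouring of B₄ and verify it by an
-- exhaustive path search that is proved sound once and for all, for any graph
-- with decidable adjacency and any decidable property P of vertex lists:
-- "Checked f v vs" says that v ∷ vs satisfies P and so does, recursively,
-- every extension of it by a fresh neighbour of its head.  Every path arises
-- from its last vertex by such extensions, so if every single vertex is
-- Checked then every path satisfies P (all-paths-satisfy).  For B₄ the check
-- is decided by computation.
--
-- Pass from a colouring of a path to its word of colours.  With
-- one colour the word of an edge is even; with two colours the words of the
-- path a-b-c-d and of its sub-paths ab, bc, cd cannot all be odd (odd pairs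
-- force a ≠ b ≠ c ≠ d, i.e. the word abab).  Both facts about words are
-- checked exhaustively.  So a graph containing a path on four vertices, such
-- as B₄, has χ_p ≥ 3.

open import Defs
open import Data.Nat using (ℕ; zero; suc; _+_; _*_; _%_; _<_; s≤s)
open import Data.Nat.Properties using () renaming (_≟_ to _≟ℕ_)
open import Data.Fin using (Fin; toℕ; #_) renaming (zero to fz)
open import Data.Fin.Properties using (_≟_; all?; any?)
open import Data.Empty using (⊥)
open import Data.List using (List; []; _∷_; _++_; _ʳ++_; map)
open import Data.List.Properties using (++-ʳ++)
open import Data.List.Membership.Propositional using (_∉_)
import Data.List.Membership.DecPropositional as DecMembership
open import Data.List.Relation.Unary.All.Properties using (All¬⇒¬Any)
open import Data.List.Relation.Unary.All using ([]; _∷_)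
open import Data.List.Relation.Unary.AllPairs using ([]; _∷_)
open import Data.Vec using (Vec; lookup) renaming ([] to []ᵥ; _∷_ to _∷ᵥ_)
open import Data.Product using (∃; ∃₂; _×_; _,_)
open import Data.Sum using (inj₁; inj₂)
open import Function using (id)
open import Relation.Binary.PropositionalEquality using (_≡_; refl; trans; cong; subst) renaming (sym to ≡-sym)
open import Relation.Nullary using (¬_; Dec; yes; no)
open import Relation.Nullary.Decidable using (from-yes; ¬?; _×-dec_; _⊎-dec_; _→-dec_)

HasOddColour : ∀ {m k} → (Fin m → Fin k) → List (Fin m) → Set
HasOddColour c vs = ∃ λ j → count c j vs % 2 ≡ 1

hasOddColour? : ∀ {m k} (c : Fin m → Fin k) vs → Dec (HasOddColour c vs)
hasOddColour? c vs = any? λ j → count c j vs % 2 ≟ℕ 1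

count-map : ∀ {m k} (c : Fin m → Fin k) j vs → count id j (map c vs) ≡ count c j vs
count-map c j [] = refl
count-map c j (v ∷ vs) with c v ≟ j
... | yes _ = cong suc (count-map c j vs)
... | no _  = count-map c j vs

OddWord : ∀ {k} → List (Fin k) → Set
OddWord {k} = HasOddColour {k} {k} id

oddWord? : ∀ {k} (xs : List (Fin k)) → Dec (OddWord xs)
oddWord? {k} = hasOddColour? {k} {k} id

oddColour-word : ∀ {m k} (c : Fin m → Fin k) vs → HasOddColour c vs → OddWord (map c vs)
oddColour-word c vs (j , odd) = j , trans (cong (_% 2) (count-map c j vs)) odd

parity-odd-word : ∀ {G k} {c : Fin (n G) → Fin k} → IsParityColouring G k c →
                  ∀ {vs} → IsPath G vs → OddWord (map c vs)
parity-odd-word {c = c} parity {vs} path = oddColour-word c vs (parity vs path)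

last-split : ∀ {A : Set} (x : A) xs → ∃₂ λ r v → r ʳ++ (v ∷ []) ≡ x ∷ xs
last-split x []       = [] , x , refl
last-split x (y ∷ ys) with last-split y ys
... | r , v , r+v≡y∷ys = r ++ (x ∷ []) , v , trans (++-ʳ++ r) (cong (x ∷_) r+v≡y∷ys)

module _ (G : Graph) where

  path-suffix : ∀ r u ps → IsPath G (r ʳ++ (u ∷ ps)) → IsPath G (u ∷ ps)
  path-suffix []      u ps p = p
  path-suffix (x ∷ r) u ps p with path-suffix r x (u ∷ ps) p
  ... | step _ walk , _ ∷ unique = walk , unique

  path-head : ∀ {u v vs} → IsPath G (u ∷ v ∷ vs) → Adj G u v × u ∉ v ∷ vs
  path-head (step adj _ , u∉ ∷ _) = adj , All¬⇒¬Any u∉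

  edge-path : ∀ {u v} → Adj G u v → IsPath G (u ∷ v ∷ [])
  edge-path adj = step adj (single _) , ((λ { refl → irrefl G adj }) ∷ []) ∷ [] ∷ []

module PathSearch (G : Graph) (adj? : ∀ u v → Dec (Adj G u v))
                  {P : List (Fin (n G)) → Set} (P? : ∀ vs → Dec (P vs)) where

  open DecMembership (_≟_ {n G}) using (_∉?_)

  -- v ∷ vs satisfies P, and so does, recursively, every extension of it by a
  -- fresh neighbour of its head; the fuel f bounds how many vertices (counting
  -- v) may still be added, and must exceed the length of any path.
  Checked : ℕ → Fin (n G) → List (Fin (n G)) → Set
  Checked zero    v vs = ⊥
  Checked (suc f) v vs =
    P (v ∷ vs) × (∀ u → Adj G u v → u ∉ v ∷ vs → Checked f u (v ∷ vs))

  checked? : ∀ f v vs → Dec (Checked f v vs)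
  checked? zero    v vs = no λ ()
  checked? (suc f) v vs =
    P? (v ∷ vs) ×-dec all? λ u → adj? u v →-dec u ∉? v ∷ vs →-dec checked? f u (v ∷ vs)

  checked-sound : ∀ f v vs → Checked f v vs →
                  ∀ r → IsPath G (r ʳ++ (v ∷ vs)) → P (r ʳ++ (v ∷ vs))
  checked-sound (suc f) v vs (holds , _)       []      _ = holds
  checked-sound (suc f) v vs (_ , extensions) (u ∷ r) p
    with path-head G (path-suffix G r u (v ∷ vs) p)
  ... | adj , fresh = checked-sound f u (v ∷ vs) (extensions u adj fresh) r p

  -- A path has at most n G vertices, so fuel n G suffices from each start.
  all-paths-satisfy : (∀ v → Checked (n G) v []) → ∀ vs → IsPath G vs → P vs
  all-paths-satisfy checked (x ∷ xs) p with last-split x xs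
  ... | r , v , r+v≡path =
    subst P r+v≡path
      (checked-sound (n G) v [] (checked v) r (subst (IsPath G) (≡-sym r+v≡path) p))

one-colour-pairs-even : (a b : Fin 1) → ¬ OddWord (a ∷ b ∷ [])
one-colour-pairs-even fz fz (fz , ())

two-colour-words-even : (a b c d : Fin 2) →
  ¬ (OddWord (a ∷ b ∷ []) × OddWord (b ∷ c ∷ []) ×
     OddWord (c ∷ d ∷ []) × OddWord (a ∷ b ∷ c ∷ d ∷ []))
two-colour-words-even = from-yes (all? λ a → all? λ b → all? λ c → all? λ d →
  ¬? (oddWord? {2} (a ∷ b ∷ []) ×-dec oddWord? {2} (b ∷ c ∷ []) ×-dec
      oddWord? {2} (c ∷ d ∷ []) ×-dec oddWord? {2} (a ∷ b ∷ c ∷ d ∷ [])))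

P₄⇒χₚ≥3 : ∀ {G p q r s} → IsPath G (p ∷ q ∷ r ∷ s ∷ []) →
          ∀ m → m < 3 → ¬ ParityColourable G m
P₄⇒χₚ≥3 {p = p} _ zero _ (c , _) with c p
... | ()
P₄⇒χₚ≥3 {G} {p} {q} (step pq _ , _) 1 _ (c , parity) =
  one-colour-pairs-even (c p) (c q) (parity-odd-word parity (edge-path G pq))
P₄⇒χₚ≥3 {G} {p} {q} {r} {s} path@(step pq (step qr (step rs _)) , _) 2 _ (c , parity) =
  two-colour-words-even (c p) (c q) (c r) (c s)
    ( parity-odd-word parity (edge-path G pq) , parity-odd-word parity (edge-path G qr)
    , parity-odd-word parity (edge-path G rs) , parity-odd-word parity path )
P₄⇒χₚ≥3 _ (suc (suc (suc _))) (s≤s (s≤s (s≤s ())))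

BAdj? : ∀ d u v → Dec (BAdj d u v)
BAdj? d u v = (toℕ v ≟ℕ 2 * toℕ u + 1 ⊎-dec toℕ v ≟ℕ 2 * toℕ u + 2)
       ⊎-dec (toℕ u ≟ℕ 2 * toℕ v + 1 ⊎-dec toℕ u ≟ℕ 2 * toℕ v + 2)

-- The 3-colouring of B₄ in heap order: root 0; its children 1 and 2; the
-- third layer 0; the leaves below the child coloured 1 get 2 and those below
-- the child coloured 2 get 1.
colour : Fin 15 → Fin 3
colour = lookup colours
  where
  colours : Vec (Fin 3) 15
  colours = # 0 ∷ᵥ # 1 ∷ᵥ # 2 ∷ᵥ # 0 ∷ᵥ # 0 ∷ᵥ # 0 ∷ᵥ # 0 ∷ᵥ
            # 2 ∷ᵥ # 2 ∷ᵥ # 2 ∷ᵥ # 2 ∷ᵥ # 1 ∷ᵥ # 1 ∷ᵥ # 1 ∷ᵥ # 1 ∷ᵥ []ᵥ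

colour-parity : IsParityColouring (B 4) 3 colour
colour-parity = all-paths-satisfy (from-yes (all? λ v → checked? (n (B 4)) v []))
  where open PathSearch (B 4) (BAdj? 4) (hasOddColour? colour)

-- The path 7 - 3 - 1 - 4 (leaf, parent, grandparent, its other child).
path-7314 : IsPath (B 4) (# 7 ∷ # 3 ∷ # 1 ∷ # 4 ∷ [])
path-7314 = step (inj₂ (inj₁ refl)) (step (inj₂ (inj₁ refl)) (step (inj₁ (inj₂ refl)) (single _)))
          , ((λ ()) ∷ (λ ()) ∷ (λ ()) ∷ []) ∷ ((λ ()) ∷ (λ ()) ∷ []) ∷ ((λ ()) ∷ []) ∷ [] ∷ []

lemma3 : ChiP≡ (B 4) 3
lemma3 = (colour , colour-parity) , P₄⇒χₚ≥3 path-7314
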